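{- We have $ac(0,0)=1$, $ac(0,1)=0$, and for all integers $n\geq 0$ and $s\geq 0$, \[ac(n,2s)+ac(n,2s+1)=ac(n+1,2s+1).\]
   Context: A composition of $n$ of length $s$ is a sequence $\sigma=(\sigma_1,\ldots,\sigma_s)$ of positive integers with $\sum_i\sigma_i=n$; the empty composition is the unique composition of $0$, of length $0$. A composition is anti-palindromic if $\sigma_i\neq\sigma_{s-i+1}$ for all $i$ with $i\neq\frac{s+1}{2}$ (the empty composition is vacuously anti-palindromic). $ac(n,s)$ is the number of anti-palindromic compositions of $n$ of length $s$. -}

module Defs where

open import Data.Nat using (ℕ; zero; suc; _∸_)
import Data.Nat as ℕ
open import Data.List using (List; []; _∷_; map; concatMap; upTo; length; filter; lookup)
open import Data.Fin using (Fin; opposite)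
import Data.Fin as Fin
import Data.Fin.Properties as FinP
open import Relation.Nullary using (¬_; Dec)
open import Relation.Nullary.Decidable using (¬?; _⊎-dec_)
open import Relation.Binary.PropositionalEquality using (_≡_; _≢_)
open import Data.Sum using (_⊎_)

compositions : ℕ → ℕ → List (List ℕ)
compositions zero    zero    = [] ∷ []
compositions (suc n) zero    = []
compositions n       (suc s) =
  concatMap (λ k → map (suc k ∷_) (compositions (n ∸ suc k) s)) (upTo n)

-- σ = (σ_0, …, σ_{s-1}) (0-indexed) is anti-palindromic iff for every index i
-- that is not the middle one (i ≠ s-1-i, i.e. i ≠ opposite i),
-- σ_i ≠ σ_{s-1-i}.
AntiPalindromic : List ℕ → Set
AntiPalindromic σ =
  (i : Fin (length σ)) → i ≡ opposite i ⊎ lookup σ i ≢ lookup σ (opposite i)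

antiPalindromic? : (σ : List ℕ) → Dec (AntiPalindromic σ)
antiPalindromic? σ =
  FinP.all? (λ i → (i FinP.≟ opposite i) ⊎-dec ¬? (lookup σ i ℕ.≟ lookup σ (opposite i)))

ac : ℕ → ℕ → ℕ
ac n s = length (filter antiPalindromic? (compositions n s))

{-# OPTIONS --safe #-}
-- Split the compositions of n + 1 of length 2s + 1 according to their middle part σ_s:
-- if σ_s = 1, deleting it leaves a composition of n of length 2s; otherwise decreasing
-- it by one leaves a composition of n of length 2s + 1. Both operations are bijections,
-- and neither changes any pair (σ_i, σ_{2s-i}) with i ≠ s, so they preserve
-- anti-palindromicity in both directions.
module Submission where

open import Defs
open import Data.Nat using (ℕ; suc; _+_; _*_)
open import Data.Product using (_×_)
open import Relation.Binary.PropositionalEquality using (_≡_)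

open import Level using (Level)
open import Data.Nat using (zero; _∸_; _≤_; _<_; z≤n; s≤s; s≤s⁻¹; z<s; s<s)
open import Data.Nat.Properties
  using (+-suc; +-identityʳ; +-comm; +-assoc; +-cancelˡ-≡; +-∸-assoc; m≤m+n; m+[n∸m]≡n;
         n∸n≡0; <-irrefl; <⇒≢; >⇒≢; ≰⇒>; +-mono-≤-<; +-mono-<-≤; <-≤-trans;
         ≤-<-trans; ≤-trans; ≤-reflexive; m<n⇒m<1+n; <-cmp; suc-injective;
         +-commutativeSemigroup)
open import Algebra.Properties.CommutativeSemigroup +-commutativeSemigroup using (interchange)
open import Data.Nat.ListAction using (sum)
open import Data.List
  using (List; []; _∷_; _++_; map; concatMap; upTo; applyUpTo; length; filter; lookup)
open import Data.List.Properties using (filter-++; length-++; map-upTo; map-cong)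
open import Data.List.Relation.Unary.All using (All; []; _∷_)
import Data.List.Relation.Unary.All as All
open import Data.List.Relation.Unary.All.Properties using (concat⁺; map⁺; applyUpTo⁺₂)
open import Data.Fin using (Fin; toℕ; fromℕ<; opposite)
open import Data.Fin.Properties using (toℕ-injective; toℕ<n; toℕ-fromℕ<; opposite-prop)
open import Data.Product using (_,_; proj₁; proj₂)
open import Data.Sum using (_⊎_; inj₁; inj₂)
open import Function using (_∘_; id; _⇔_; mk⇔; Equivalence)
open import Function.Construct.Composition using (_⇔-∘_)
open import Function.Construct.Symmetry using (⇔-sym)
open import Relation.Nullary using (yes; no; contradiction)
open import Relation.Unary using (Pred; Decidable)
open import Relation.Binary.Definitions using (tri<; tri≈; tri>)
open import Relation.Binary.PropositionalEquality
  using (_≢_; refl; sym; trans; cong; cong₂; module ≡-Reasoning)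

open ≡-Reasoning

private
  variable
    a b p q : Level
    A B : Set a

count : {P : Pred A p} → Decidable P → List A → ℕ
count P? xs = length (filter P? xs)

module _ {P : Pred A p} (P? : Decidable P) where

  count-++ : ∀ xs ys → count P? (xs ++ ys) ≡ count P? xs + count P? ys
  count-++ xs ys = trans (cong length (filter-++ P? xs ys)) (length-++ (filter P? xs))

  count-map : (f : B → A) (xs : List B) → count P? (map f xs) ≡ count (P? ∘ f) xs
  count-map f [] = refl
  count-map f (x ∷ xs) with P? (f x)
  ... | yes _ = cong suc (count-map f xs)
  ... | no  _ = count-map f xs

  count-concatMap : (f : B → List A) (xs : List B) →
                    count P? (concatMap f xs) ≡ sum (map (count P? ∘ f) xs)
  count-concatMap f [] = refl
  count-concatMap f (x ∷ xs) =
    trans (count-++ (f x) (concatMap f xs)) (cong (count P? (f x) +_) (count-concatMap f xs))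

count-cong-local : {P : Pred A p} {Q : Pred A q} (P? : Decidable P) (Q? : Decidable Q) {xs : List A} →
                   All (λ x → P x ⇔ Q x) xs → count P? xs ≡ count Q? xs
count-cong-local P? Q? [] = refl
count-cong-local P? Q? {x ∷ _} (P⇔Q ∷ rest) with P? x | Q? x
... | yes _  | yes _  = cong suc (count-cong-local P? Q? rest)
... | no  _  | no  _  = count-cong-local P? Q? rest
... | yes px | no ¬qx = contradiction (Equivalence.to P⇔Q px) ¬qx
... | no ¬px | yes qx = contradiction (Equivalence.from P⇔Q qx) ¬px

sum-applyUpTo-suc : (f : ℕ → ℕ) (n : ℕ) →
                    sum (applyUpTo f (suc n)) ≡ sum (applyUpTo f n) + f n
sum-applyUpTo-suc f zero    = +-identityʳ (f 0)
sum-applyUpTo-suc f (suc n) =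
  trans (cong (f 0 +_) (sum-applyUpTo-suc (f ∘ suc) n)) (sym (+-assoc (f 0) _ _))

sum-applyUpTo-cong : {f g : ℕ → ℕ} (n : ℕ) → (∀ {j} → j < n → f j ≡ g j) →
                     sum (applyUpTo f n) ≡ sum (applyUpTo g n)
sum-applyUpTo-cong zero    f≡g = refl
sum-applyUpTo-cong (suc n) f≡g = cong₂ _+_ (f≡g z<s) (sum-applyUpTo-cong n (f≡g ∘ s<s))

sum-applyUpTo-+ : (f g : ℕ → ℕ) (n : ℕ) →
                  sum (applyUpTo (λ j → f j + g j) n) ≡ sum (applyUpTo f n) + sum (applyUpTo g n)
sum-applyUpTo-+ f g zero    = refl
sum-applyUpTo-+ f g (suc n) =
  trans (cong (f 0 + g 0 +_) (sum-applyUpTo-+ (f ∘ suc) (g ∘ suc) n)) (interchange (f 0) (g 0) _ _)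

compositions-suc : ∀ n s →
  compositions n (suc s) ≡
  concatMap (λ k → map (suc k ∷_) (compositions (n ∸ suc k) s)) (upTo n)
compositions-suc zero    s = refl
compositions-suc (suc n) s = refl

compositions-length : ∀ n s → All (λ σ → length σ ≡ s) (compositions n s)
compositions-length zero    zero    = refl ∷ []
compositions-length (suc n) zero    = []
compositions-length zero    (suc s) = []
compositions-length (suc n) (suc s) =
  concat⁺ (map⁺ (applyUpTo⁺₂ id (suc n) λ k →
    map⁺ (All.map (cong suc) (compositions-length (suc n ∸ suc k) s))))

count-compositions-suc : {P : Pred (List ℕ) p} (P? : Decidable P) → ∀ n s →
  count P? (compositions n (suc s)) ≡
  sum (applyUpTo (λ k → count (P? ∘ (suc k ∷_)) (compositions (n ∸ suc k) s)) n)
count-compositions-suc P? n s = begin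
  count P? (compositions n (suc s))          ≡⟨ cong (count P?) (compositions-suc n s) ⟩
  count P? (concatMap withFirst (upTo n))     ≡⟨ count-concatMap P? withFirst (upTo n) ⟩
  sum (map (count P? ∘ withFirst) (upTo n))   ≡⟨ cong sum (map-cong countWithFirst (upTo n)) ⟩
  sum (map byFirst (upTo n))                  ≡⟨ cong sum (map-upTo byFirst n) ⟩
  sum (applyUpTo byFirst n)                   ∎
  where
  withFirst : ℕ → List (List ℕ)
  withFirst k = map (suc k ∷_) (compositions (n ∸ suc k) s)
  byFirst : ℕ → ℕ
  byFirst k = count (P? ∘ (suc k ∷_)) (compositions (n ∸ suc k) s)
  countWithFirst : ∀ k → count P? (withFirst k) ≡ byFirst k
  countWithFirst k = count-map P? (suc k ∷_) (compositions (n ∸ suc k) s)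

insertAt : ℕ → A → List A → List A
insertAt zero    x ys       = x ∷ ys
insertAt (suc k) x []       = x ∷ []
insertAt (suc k) x (y ∷ ys) = y ∷ insertAt k x ys

incrementAt : ℕ → List ℕ → List ℕ
incrementAt k       []       = []
incrementAt zero    (y ∷ ys) = suc y ∷ ys
incrementAt (suc k) (y ∷ ys) = y ∷ incrementAt k ys

-- Position k of a composition of n + 1 is either a part 1, which insertAt k 1 restores,
-- or a larger part, which incrementAt k restores.
count-compositions-split : ∀ {k L} → k ≤ L → ∀ n {P : Pred (List ℕ) p} (P? : Decidable P) →
  count P? (compositions (suc n) (suc L)) ≡
  count (P? ∘ insertAt k 1) (compositions n L) + count (P? ∘ incrementAt k) (compositions n (suc L))
count-compositions-split {L = L} z≤n n P? = begin
  count P? (compositions (suc n) (suc L))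
    ≡⟨ count-compositions-suc P? (suc n) L ⟩
  count (P? ∘ (1 ∷_)) (compositions n L) +
  sum (applyUpTo (λ j → count (P? ∘ (suc (suc j) ∷_)) (compositions (n ∸ suc j) L)) n)
    ≡⟨ cong (count (P? ∘ (1 ∷_)) (compositions n L) +_)
            (count-compositions-suc (P? ∘ incrementAt 0) n L) ⟨
  count (P? ∘ insertAt 0 1) (compositions n L) + count (P? ∘ incrementAt 0) (compositions n (suc L))
    ∎
count-compositions-split {k = suc k} {L = suc L} (s≤s k≤L) n P? = begin
  count P? (compositions (suc n) (suc (suc L)))
    ≡⟨ count-compositions-suc P? (suc n) (suc L) ⟩
  sum (applyUpTo byFirst (suc n))
    ≡⟨ sum-applyUpTo-suc byFirst n ⟩
  sum (applyUpTo byFirst n) + byFirst n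
    ≡⟨ cong₂ _+_ (sum-applyUpTo-cong n splitFirst) lastVanishes ⟩
  sum (applyUpTo (λ j → inserted j + incremented j) n) + 0
    ≡⟨ +-identityʳ _ ⟩
  sum (applyUpTo (λ j → inserted j + incremented j) n)
    ≡⟨ sum-applyUpTo-+ inserted incremented n ⟩
  sum (applyUpTo inserted n) + sum (applyUpTo incremented n)
    ≡⟨ sym (cong₂ _+_ (count-compositions-suc (P? ∘ insertAt (suc k) 1) n L)
                      (count-compositions-suc (P? ∘ incrementAt (suc k)) n (suc L))) ⟩
  count (P? ∘ insertAt (suc k) 1) (compositions n (suc L)) +
  count (P? ∘ incrementAt (suc k)) (compositions n (suc (suc L)))
    ∎
  where
  byFirst inserted incremented : ℕ → ℕ
  byFirst     j = count (P? ∘ (suc j ∷_)) (compositions (n ∸ j) (suc L))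
  inserted    j = count (P? ∘ (suc j ∷_) ∘ insertAt k 1) (compositions (n ∸ suc j) L)
  incremented j = count (P? ∘ (suc j ∷_) ∘ incrementAt k) (compositions (n ∸ suc j) (suc L))

  splitFirst : ∀ {j} → j < n → byFirst j ≡ inserted j + incremented j
  -- +-∸-assoc 1 j<n : n ∸ j ≡ suc (n ∸ suc j), as (1 + n) ∸ suc j reduces to n ∸ j.
  splitFirst {j} j<n rewrite +-∸-assoc 1 j<n =
    count-compositions-split k≤L (n ∸ suc j) (P? ∘ (suc j ∷_))

  lastVanishes : byFirst n ≡ 0
  lastVanishes rewrite n∸n≡0 n = refl

length-insertAt : ∀ k (x : A) xs → length (insertAt k x xs) ≡ suc (length xs)
length-insertAt zero    x xs       = refl
length-insertAt (suc k) x []       = refl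
length-insertAt (suc k) x (y ∷ xs) = cong suc (length-insertAt k x xs)

length-incrementAt : ∀ k xs → length (incrementAt k xs) ≡ length xs
length-incrementAt k       []       = refl
length-incrementAt zero    (y ∷ xs) = refl
length-incrementAt (suc k) (y ∷ xs) = cong suc (length-incrementAt k xs)

-- Total lookup: out-of-range indices give 0.
_‼_ : List ℕ → ℕ → ℕ
[]      ‼ _     = 0
(x ∷ _) ‼ zero  = x
(_ ∷ xs) ‼ suc i = xs ‼ i

lookup≡‼ : ∀ xs (i : Fin (length xs)) → lookup xs i ≡ xs ‼ toℕ i
lookup≡‼ (x ∷ xs) Fin.zero    = refl
lookup≡‼ (x ∷ xs) (Fin.suc i) = lookup≡‼ xs i

insertAt-‼-< : ∀ {k j} x xs → j < k → k ≤ length xs → insertAt k x xs ‼ j ≡ xs ‼ j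
insertAt-‼-< {suc k} {zero}  x (y ∷ xs) j<k       k≤len       = refl
insertAt-‼-< {suc k} {suc j} x (y ∷ xs) (s<s j<k) (s≤s k≤len) = insertAt-‼-< x xs j<k k≤len

insertAt-‼-≥ : ∀ {k j} x xs → k ≤ j → insertAt k x xs ‼ suc j ≡ xs ‼ j
insertAt-‼-≥ {zero}          x xs       k≤j       = refl
insertAt-‼-≥ {suc k}         x []       k≤j       = refl
insertAt-‼-≥ {suc k} {suc j} x (y ∷ xs) (s≤s k≤j) = insertAt-‼-≥ x xs k≤j

incrementAt-‼-≢ : ∀ {k j} xs → j ≢ k → incrementAt k xs ‼ j ≡ xs ‼ j
incrementAt-‼-≢         []       j≢k = refl
incrementAt-‼-≢ {zero}  {zero}  (y ∷ xs) j≢k = contradiction refl j≢k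
incrementAt-‼-≢ {zero}  {suc j} (y ∷ xs) j≢k = refl
incrementAt-‼-≢ {suc k} {zero}  (y ∷ xs) j≢k = refl
incrementAt-‼-≢ {suc k} {suc j} (y ∷ xs) j≢k = incrementAt-‼-≢ xs (j≢k ∘ cong suc)

-- AntiPalindromic with ℕ indices: positions i < j are mirror images iff i + j + 1 is the length.
MirrorDistinct : List ℕ → Set
MirrorDistinct xs = ∀ {i j} → i < j → suc (i + j) ≡ length xs → xs ‼ i ≢ xs ‼ j

toℕ-opposite-mirror : ∀ {n} (i : Fin n) → suc (toℕ i + toℕ (opposite i)) ≡ n
toℕ-opposite-mirror i =
  trans (cong (λ m → suc (toℕ i + m)) (opposite-prop i)) (m+[n∸m]≡n (toℕ<n i))

antiPalindromic⇔mirrorDistinct : ∀ xs → AntiPalindromic xs ⇔ MirrorDistinct xs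
antiPalindromic⇔mirrorDistinct xs = mk⇔ to from
  where
  distinct⇒lookup-distinct : ∀ {i j} →
    xs ‼ toℕ i ≢ xs ‼ toℕ j → lookup xs i ≢ lookup xs j
  distinct⇒lookup-distinct {i} {j} ne eq =
    ne (trans (sym (lookup≡‼ xs i)) (trans eq (lookup≡‼ xs j)))

  to : AntiPalindromic xs → MirrorDistinct xs
  to ap {i} {j} i<j mirror = distinct (ap f)
    where
    i<len : i < length xs
    i<len = ≤-trans (s≤s (m≤m+n i j)) (≤-reflexive mirror)
    f : Fin (length xs)
    f = fromℕ< i<len
    f≡i : toℕ f ≡ i
    f≡i = toℕ-fromℕ< i<len
    opposite≡j : toℕ (opposite f) ≡ j
    opposite≡j = +-cancelˡ-≡ i _ _ (suc-injective (begin
      suc (i + toℕ (opposite f))      ≡⟨ cong (λ m → suc (m + toℕ (opposite f))) f≡i ⟨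
      suc (toℕ f + toℕ (opposite f))  ≡⟨ toℕ-opposite-mirror f ⟩
      length xs                       ≡⟨ mirror ⟨
      suc (i + j)                     ∎))
    distinct : f ≡ opposite f ⊎ lookup xs f ≢ lookup xs (opposite f) → xs ‼ i ≢ xs ‼ j
    distinct (inj₁ fixed) =
      contradiction (trans (sym f≡i) (trans (cong toℕ fixed) opposite≡j)) (<⇒≢ i<j)
    distinct (inj₂ ne) eq = ne (begin
      lookup xs f                 ≡⟨ lookup≡‼ xs f ⟩
      xs ‼ toℕ f                  ≡⟨ cong (xs ‼_) f≡i ⟩
      xs ‼ i                      ≡⟨ eq ⟩
      xs ‼ j                      ≡⟨ cong (xs ‼_) opposite≡j ⟨
      xs ‼ toℕ (opposite f)       ≡⟨ lookup≡‼ xs (opposite f) ⟨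
      lookup xs (opposite f)      ∎)

  from : MirrorDistinct xs → AntiPalindromic xs
  from md f with <-cmp (toℕ f) (toℕ (opposite f))
  ... | tri< lt _ _ = inj₂ (distinct⇒lookup-distinct (md lt (toℕ-opposite-mirror f)))
  ... | tri≈ _ eq _ = inj₁ (toℕ-injective eq)
  ... | tri> _ _ gt = inj₂ (distinct⇒lookup-distinct λ eq →
    md gt (trans (cong suc (+-comm (toℕ (opposite f)) (toℕ f))) (toℕ-opposite-mirror f)) (sym eq))

straddles-middle : ∀ {i j m} → i < j → i + j ≡ m + m → i < m × m < j
straddles-middle {i} {j} {m} i<j i+j≡m+m =
    ≰⇒> (λ m≤i → <-irrefl (sym i+j≡m+m) (+-mono-≤-< m≤i (≤-<-trans m≤i i<j)))
  , ≰⇒> (λ j≤m → <-irrefl i+j≡m+m (+-mono-<-≤ (<-≤-trans i<j j≤m) j≤m))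

mirrorDistinct-insertAt-middle : ∀ s x xs → length xs ≡ s + s →
  MirrorDistinct (insertAt s x xs) ⇔ MirrorDistinct xs
mirrorDistinct-insertAt-middle s x xs len = mk⇔ to from
  where
  ys : List ℕ
  ys = insertAt s x xs

  length-ys : length ys ≡ suc (s + s)
  length-ys = trans (length-insertAt s x xs) (cong suc len)

  before : ∀ {j} → j < s → ys ‼ j ≡ xs ‼ j
  before j<s = insertAt-‼-< x xs j<s (≤-trans (m≤m+n _ _) (≤-reflexive (sym len)))

  after : ∀ {j} → s ≤ j → ys ‼ suc j ≡ xs ‼ j
  after = insertAt-‼-≥ x xs

  to : MirrorDistinct ys → MirrorDistinct xs
  to md {i} {j} i<j mirror eq =
    md (m<n⇒m<1+n i<j) (trans (cong suc i+1+j≡s+s) (sym length-ys))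
       (trans (before i<s) (trans eq (sym (after (s≤s⁻¹ s<1+j)))))
    where
    i+1+j≡s+s : i + suc j ≡ s + s
    i+1+j≡s+s = trans (+-suc i j) (trans mirror len)
    i<s : i < s
    i<s = proj₁ (straddles-middle (m<n⇒m<1+n i<j) i+1+j≡s+s)
    s<1+j : s < suc j
    s<1+j = proj₂ (straddles-middle (m<n⇒m<1+n i<j) i+1+j≡s+s)

  from : MirrorDistinct xs → MirrorDistinct ys
  from md {i} {zero}  ()  mirror eq
  from md {i} {suc j} i<1+j mirror eq =
    md (<-≤-trans i<s s≤j) (trans (sym (+-suc i j)) (trans i+1+j≡s+s (sym len)))
       (trans (sym (before i<s)) (trans eq (after s≤j)))
    where
    i+1+j≡s+s : i + suc j ≡ s + s
    i+1+j≡s+s = suc-injective (trans mirror length-ys)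
    i<s : i < s
    i<s = proj₁ (straddles-middle i<1+j i+1+j≡s+s)
    s≤j : s ≤ j
    s≤j = s≤s⁻¹ (proj₂ (straddles-middle i<1+j i+1+j≡s+s))

mirrorDistinct-agreeing-off-middle : ∀ {s} xs ys →
  length xs ≡ suc (s + s) → length ys ≡ length xs →
  (∀ {j} → j ≢ s → ys ‼ j ≡ xs ‼ j) → MirrorDistinct xs → MirrorDistinct ys
mirrorDistinct-agreeing-off-middle {s} xs ys len length-ys agree md {i} {j} i<j mirror eq =
  md i<j (trans mirror length-ys) (trans (sym (agree (<⇒≢ i<s))) (trans eq (agree (>⇒≢ s<j))))
  where
  i+j≡s+s : i + j ≡ s + s
  i+j≡s+s = suc-injective (trans mirror (trans length-ys len))
  i<s : i < s
  i<s = proj₁ (straddles-middle i<j i+j≡s+s)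
  s<j : s < j
  s<j = proj₂ (straddles-middle i<j i+j≡s+s)

mirrorDistinct-incrementAt-middle : ∀ s xs → length xs ≡ suc (s + s) →
  MirrorDistinct (incrementAt s xs) ⇔ MirrorDistinct xs
mirrorDistinct-incrementAt-middle s xs len = mk⇔
  (mirrorDistinct-agreeing-off-middle ys xs (trans length-ys len) (sym length-ys)
    (sym ∘ incrementAt-‼-≢ xs))
  (mirrorDistinct-agreeing-off-middle xs ys len length-ys (incrementAt-‼-≢ xs))
  where
  ys : List ℕ
  ys = incrementAt s xs
  length-ys : length ys ≡ length xs
  length-ys = length-incrementAt s xs

2*n≡n+n : ∀ n → 2 * n ≡ n + n
2*n≡n+n n = cong (n +_) (+-identityʳ n)

antiPalindromic-insertAt-middle : ∀ s x xs → length xs ≡ 2 * s →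
  AntiPalindromic (insertAt s x xs) ⇔ AntiPalindromic xs
antiPalindromic-insertAt-middle s x xs len =
  ⇔-sym (antiPalindromic⇔mirrorDistinct xs)
    ⇔-∘ (mirrorDistinct-insertAt-middle s x xs (trans len (2*n≡n+n s))
    ⇔-∘ antiPalindromic⇔mirrorDistinct (insertAt s x xs))

antiPalindromic-incrementAt-middle : ∀ s xs → length xs ≡ suc (2 * s) →
  AntiPalindromic (incrementAt s xs) ⇔ AntiPalindromic xs
antiPalindromic-incrementAt-middle s xs len =
  ⇔-sym (antiPalindromic⇔mirrorDistinct xs)
    ⇔-∘ (mirrorDistinct-incrementAt-middle s xs (trans len (cong suc (2*n≡n+n s)))
    ⇔-∘ antiPalindromic⇔mirrorDistinct (incrementAt s xs))

ac-insertAt-middle : ∀ n s →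
  count (antiPalindromic? ∘ insertAt s 1) (compositions n (2 * s)) ≡ ac n (2 * s)
ac-insertAt-middle n s = count-cong-local _ antiPalindromic?
  (All.map (λ {xs} → antiPalindromic-insertAt-middle s 1 xs) (compositions-length n (2 * s)))

ac-incrementAt-middle : ∀ n s →
  count (antiPalindromic? ∘ incrementAt s) (compositions n (suc (2 * s))) ≡ ac n (suc (2 * s))
ac-incrementAt-middle n s = count-cong-local _ antiPalindromic?
  (All.map (λ {xs} → antiPalindromic-incrementAt-middle s xs) (compositions-length n (suc (2 * s))))

proposition2 : (ac 0 0 ≡ 1) × (ac 0 1 ≡ 0)
    × ((n s : ℕ) → ac n (2 * s) + ac n (suc (2 * s)) ≡ ac (suc n) (suc (2 * s)))
proposition2 = refl , refl , λ n s → begin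
  ac n (2 * s) + ac n (suc (2 * s))
    ≡⟨ cong₂ _+_ (ac-insertAt-middle n s) (ac-incrementAt-middle n s) ⟨
  count (antiPalindromic? ∘ insertAt s 1) (compositions n (2 * s)) +
  count (antiPalindromic? ∘ incrementAt s) (compositions n (suc (2 * s)))
    ≡⟨ count-compositions-split (m≤m+n s (s + 0)) n antiPalindromic? ⟨
  ac (suc n) (suc (2 * s))
    ∎
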